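{- Let $k\ge3$, $m\ge1$, $W=I_2(k)$, and let $\Gamma^{(m)}$ be the $m$-cluster complex of $W$ with Fomin–Reading rotation $\mathcal{R}_m$. Let $d>2$ be a divisor of $mk+2$ and let $W_X$ be a parabolic subgroup of $W$ with $W_X\neq W$. Then no face of $\Gamma^{(m)}$ of parabolic type $W_X$ is fixed by $\mathcal{R}_m^{(mk+2)/d}$.
   Context: $W=I_2(k)$ is the dihedral group of order $2k$ with root system $\Phi$, simple roots $\alpha_1,\alpha_2$, simple reflections $s_1,s_2$, $c_+=s_1$, $c_-=s_2$, $c=c_+c_-$, Coxeter number $h=k$. Almost positive roots: $\Phi_{\ge-1}=\Phi_+\cup\{ -\alpha_1,-\alpha_2\}$. Fomin–Zelevinsky rotation: $\tau_+(\alpha)=\alpha$ if $\alpha=-\alpha_2$, else $c_+(\alpha)$; $\tau_-(\alpha)=\alpha$ if $\alpha=-\alpha_1$, else $c_-(\alpha)$; $\mathcal{R}=\tau_-\tau_+$. $m$-colored almost positive roots: $\Phi^{(m)}_{\ge-1}=\{\alpha^i:\alpha\in\Phi_+,1\le i\le m\}\cup\{(-\alpha_1)^1,(-\alpha_2)^1\}$. Fomin–Reading rotation: $\mathcal{R}_m(\alpha^i)=\alpha^{i+1}$ if $\alpha\in\Phi_+$ and $i<m$, and $\mathcal{R}_m(\alpha^i)=(\mathcal{R}(\alpha))^1$ otherwise; its order divides $mk+2$. Compatibility $\|$: the unique symmetric relation with $(-\alpha_j)^1\|\beta^i$ iff $\alpha_j$ has coefficient $0$ in $\beta$, and $\mathcal{R}_m(x)\|\mathcal{R}_m(y)\iff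 x\|y$. $\Gamma^{(m)}$ is the simplicial complex of pairwise compatible sets. Parabolic type of a face $f=\{\beta_1^{i_1},\dots,\beta_r^{i_r}\}$: order it so that $t_{\beta_1}\cdots t_{\beta_r}$ lies in the absolute-order interval $[e,c]$ ($t_\beta$ the reflection of $\beta$), put $\underline f=c_+t_{\beta_1}\cdots t_{\beta_r}c_-$, and take the conjugacy class of the pointwise stabilizer $W_{\underline f}$ of $\mathrm{Fix}(\underline f)$. (The empty face has type $W$, vertices have rank-one types, facets have trivial type.) -}

module Defs where

open import Data.Nat using (ℕ; zero; suc; _+_; _*_; _∸_; _<_; _≡ᵇ_; _<ᵇ_)
open import Data.Bool using (if_then_else_)
open import Data.Product using (Σ; ∃; _×_; _,_; proj₁; proj₂)
open import Data.Sum using (_⊎_)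
open import Data.Unit using (⊤)
open import Data.Empty using (⊥)
open import Data.List using (List; []; _∷_; map)
open import Data.List.Relation.Unary.All using (All)
open import Data.List.Relation.Unary.AllPairs using (AllPairs)
open import Data.List.Relation.Binary.Subset.Propositional using (_⊆_)
open import Relation.Binary.PropositionalEquality using (_≡_)

-- The 2k roots are ρ_i (i mod 2k), ρ_i at angle iπ/k, so ρ_{i+k} = -ρ_i.
-- Simple roots: α₁ = ρ_0, α₂ = ρ_{k-1} (angle π - π/k between them).
-- Positive roots: ρ_0, …, ρ_{k-1}.  -α₁ = ρ_k, -α₂ = ρ_{2k-1}.
-- The reflection t_j := t_{ρ_j} acts by ρ_i ↦ ρ_{2j+k-i}; hence
-- s₁ = t_0 : ρ_i ↦ ρ_{k-i},   s₂ = t_{k-1} : ρ_i ↦ ρ_{k-2-i}.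

data APRoot : Set where
  pos  : ℕ → APRoot      -- pos i = ρ_i, meaningful for i < k
  neg₁ : APRoot
  neg₂ : APRoot

-- τ₊ : fixes -α₂, otherwise acts by c₊ = s₁
τ₊ : ℕ → APRoot → APRoot
τ₊ k neg₂          = neg₂
τ₊ k neg₁          = pos 0
τ₊ k (pos zero)    = neg₁
τ₊ k (pos (suc i)) = pos (k ∸ suc i)

-- τ₋ : fixes -α₁, otherwise acts by c₋ = s₂
τ₋ : ℕ → APRoot → APRoot
τ₋ k neg₁    = neg₁
τ₋ k neg₂    = pos (k ∸ 1)
τ₋ k (pos i) = if suc i ≡ᵇ k
               then neg₂
               else pos (k ∸ 2 ∸ i)

ℛ : ℕ → APRoot → APRoot
ℛ k α = τ₋ k (τ₊ k α)

-- m-coloured almost positive roots: (α , c) stands for α^{c+1}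
-- (colours are 0-based here).

CRoot : Set
CRoot = APRoot × ℕ

Valid : ℕ → ℕ → CRoot → Set
Valid k m (pos i , c) = i < k × c < m
Valid k m (neg₁  , c) = c ≡ 0
Valid k m (neg₂  , c) = c ≡ 0

ℛₘ : ℕ → ℕ → CRoot → CRoot
ℛₘ k m (pos i , c) = if suc c <ᵇ m then (pos i , suc c) else (ℛ k (pos i) , 0)
ℛₘ k m (neg₁  , c) = (ℛ k neg₁ , 0)
ℛₘ k m (neg₂  , c) = (ℛ k neg₂ , 0)

iter : {A : Set} → ℕ → (A → A) → A → A
iter zero    f x = x
iter (suc n) f x = f (iter n f x)

data Simple : Set where
  one two : Simple

negSimple : Simple → APRoot
negSimple one = neg₁
negSimple two = neg₂

CoeffZero : ℕ → Simple → APRoot → Set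
CoeffZero k one (pos i) = suc i ≡ k       -- only α₂ = ρ_{k-1} has no α₁
CoeffZero k two (pos i) = i ≡ 0           -- only α₁ = ρ_0 has no α₂
CoeffZero k one neg₁    = ⊥
CoeffZero k one neg₂    = ⊤
CoeffZero k two neg₁    = ⊤
CoeffZero k two neg₂    = ⊥

BaseCompat : ℕ → CRoot → CRoot → Set
BaseCompat k x y =
  Σ Simple λ j → proj₁ x ≡ negSimple j × proj₂ x ≡ 0 × CoeffZero k j (proj₁ y)

-- Compatibility: the symmetric, ℛ_m-invariant relation determined by the
-- base rule (transport both arguments along ℛ_m until one of them is a
-- negative simple root).
Compatible : ℕ → ℕ → CRoot → CRoot → Set
Compatible k m x y =
  ∃ λ n → BaseCompat k (iter n (ℛₘ k m) x) (iter n (ℛₘ k m) y)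
        ⊎ BaseCompat k (iter n (ℛₘ k m) y) (iter n (ℛₘ k m) x)

IsFace : ℕ → ℕ → List CRoot → Set
IsFace k m f = All (Valid k m) f × AllPairs (Compatible k m) f

FixedBy : ℕ → ℕ → ℕ → List CRoot → Set
FixedBy k m p f = map (iter p (ℛₘ k m)) f ⊆ f × f ⊆ map (iter p (ℛₘ k m)) f

-- Elements of W acting on root indices (mod 2k).

data WElt : Set where
  rot : ℕ → WElt
  ref : ℕ → WElt

ModEq : ℕ → ℕ → ℕ → Set
ModEq n a b = ∃ λ q → a ≡ b + q * n ⊎ b ≡ a + q * n

act : ℕ → WElt → ℕ → ℕ
act k (rot a) i = i + 2 * a
act k (ref j) i = 2 * j + k + (2 * k ∸ 1) * i     -- -i ≡ (2k-1)i mod 2k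

-- t_{ρ_i} = t_{ρ_j}  iff  ρ_i = ± ρ_j
SameRefl : ℕ → ℕ → ℕ → Set
SameRefl k i j = ModEq (2 * k) i j ⊎ ModEq (2 * k) i (j + k)

data ParSub : Set where
  whole   : ParSub
  rank1   : ℕ → ParSub        -- rank1 j = ⟨ t_{ρ_j} ⟩
  trivial : ParSub

-- conjugacy of parabolic subgroups:  w ⟨t_{ρ_i}⟩ w⁻¹ = ⟨t_{w ρ_i}⟩
Conjugate : ℕ → ParSub → ParSub → Set
Conjugate k whole     whole     = ⊤
Conjugate k trivial   trivial   = ⊤
Conjugate k (rank1 i) (rank1 j) = ∃ λ (w : WElt) → SameRefl k (act k w i) j
Conjugate k _         _         = ⊥

rootIdx : ℕ → APRoot → ℕ
rootIdx k (pos i) = i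
rootIdx k neg₁    = k
rootIdx k neg₂    = 2 * k ∸ 1

-- t_a t_b t_c = t_{a-b+c}  (reflection indices mod k; -b ≡ (k-1) b)
tProd3 : ℕ → ℕ → ℕ → ℕ → ℕ
tProd3 k a b c = a + (k ∸ 1) * b + c

-- Parabolic type (representative W_{f̲}) of a face:
--  * empty face: f̲ = c₊ c₋ = c, Fix = 0, stabiliser W;
--  * vertex β^i: f̲ = c₊ t_β c₋ = t_0 t_β t_{k-1}, a reflection, whose
--    fixed line has pointwise stabiliser ⟨f̲⟩;
--  * facets (two elements): f̲ = e, trivial type.
faceType : ℕ → List CRoot → ParSub
faceType k []            = whole
faceType k (x ∷ [])      = rank1 (tProd3 k 0 (rootIdx k (proj₁ x)) (k ∸ 1))
faceType k (x ∷ y ∷ f)   = trivial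

-- ℛₘ runs through the m colours of a positive root ρᵢ and then moves on to ρᵢ₋₂ (to -α₁
-- from ρ₀, to -α₂ from ρ₁). So from (-α₁)¹ and (-α₂)¹ it descends along ρ_{k-2}, ρ_{k-4}, …
-- and α₂ = ρ_{k-1}, ρ_{k-3}, …, spending m steps on each root. When 3p ≤ mk + 2 both descents
-- are still under way after p steps, at the same colour of ρᵢ and ρᵢ₊₁ with ρᵢ ≠ α₂.
-- Every vertex reaches a negative simple root, so ℛₘᵖ fixes no vertex. Compatibility is
-- ℛₘ-invariant, so a vertex x compatible with ℛₘᵖ x could be rotated together with ℛₘᵖ x
-- until one of the two is a negative simple root, and the position of the descents then
-- contradicts the base rule. Hence a face fixed by ℛₘᵖ has no vertex, whereas faces of type
-- other than W are nonempty.
module Submission where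

open import Defs
open import Data.Bool using (true; false; T)
open import Data.Nat
open import Data.Nat.Properties
open import Data.Nat.DivMod using (_/_; _%_; m≡m%n+[m/n]*n; m%n<n)
open import Data.Nat.Tactic.RingSolver using (solve-∀)
open import Data.Product using (∃₂; _,_; proj₁)
open import Data.Sum using (inj₁; inj₂)
open import Data.Unit using (tt)
open import Data.Empty using (⊥-elim)
open import Data.List using (List; []; _∷_)
open import Data.List.Relation.Unary.All using (All; _∷_; lookup)
open import Data.List.Relation.Unary.AllPairs using (_∷_)
open import Data.List.Relation.Unary.Any using (here; there)
open import Data.List.Membership.Propositional using (_∉_)
open import Data.List.Membership.Propositional.Properties using (∈-map⁺)
open import Function using (_∘_)
open import Relation.Binary.PropositionalEquality
open import Relation.Nullary using (¬_; yes; no; contradiction)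

private variable
  k m i c n r t : ℕ

module _ {A : Set} (f : A → A) where

  iter-+ : ∀ a b x → iter (a + b) f x ≡ iter a f (iter b f x)
  iter-+ zero    b x = refl
  iter-+ (suc a) b x = cong f (iter-+ a b x)

  iter-sucʳ : ∀ a x → iter (suc a) f x ≡ iter a f (f x)
  iter-sucʳ a x = trans (cong (λ b → iter b f x) (+-comm 1 a)) (iter-+ a 1 x)

  iter-comm : ∀ a b x → iter a f (iter b f x) ≡ iter b f (iter a f x)
  iter-comm a b x = begin
    iter a f (iter b f x)  ≡⟨ iter-+ a b x ⟨
    iter (a + b) f x       ≡⟨ cong (λ n → iter n f x) (+-comm a b) ⟩
    iter (b + a) f x       ≡⟨ iter-+ b a x ⟩
    iter b f (iter a f x)  ∎
    where open ≡-Reasoning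

  iter-preserves : {P : A → Set} → (∀ {x} → P x → P (f x)) → ∀ a {x} → P x → P (iter a f x)
  iter-preserves step zero    px = px
  iter-preserves {P} step (suc a) px = step (iter-preserves {P} step a px)

≡ᵇ-refl : ∀ n → (n ≡ᵇ n) ≡ true
≡ᵇ-refl zero    = refl
≡ᵇ-refl (suc n) = ≡ᵇ-refl n

<⇒≡ᵇ≡false : n < m → (n ≡ᵇ m) ≡ false
<⇒≡ᵇ≡false {zero}  (s≤s _) = refl
<⇒≡ᵇ≡false {suc n} (s≤s n<m) = <⇒≡ᵇ≡false n<m

<⇒<ᵇ≡true : n < m → (n <ᵇ m) ≡ true
<⇒<ᵇ≡true {zero}  (s≤s _) = refl
<⇒<ᵇ≡true {suc n} (s≤s n<m) = <⇒<ᵇ≡true n<m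

<ᵇ-irrefl : ∀ n → (n <ᵇ n) ≡ false
<ᵇ-irrefl zero    = refl
<ᵇ-irrefl (suc n) = <ᵇ-irrefl n

ℛ-ρ₁ : 1 < k → ℛ k (pos 1) ≡ neg₂
ℛ-ρ₁ {k = suc (suc k)} (s≤s (s≤s _)) rewrite ≡ᵇ-refl k = refl

ℛ-descends : ∀ i → 2 + i < k → ℛ k (pos (2 + i)) ≡ pos i
ℛ-descends {k = suc (suc (suc k))} i (s≤s (s≤s (s≤s i≤k)))
  rewrite <⇒≡ᵇ≡false (s≤s (m∸n≤m (suc k) i)) = cong pos (m∸[m∸n]≡n (m≤n⇒m≤1+n i≤k))

ℛₘ-colour : suc c < m → ℛₘ k m (pos i , c) ≡ (pos i , suc c)
ℛₘ-colour c+1<m rewrite <⇒<ᵇ≡true c+1<m = refl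

ℛₘ-last : suc c ≡ m → ℛₘ k m (pos i , c) ≡ (ℛ k (pos i) , 0)
ℛₘ-last {c = c} refl rewrite <ᵇ-irrefl c = refl

iter-colours : ∀ t → c + t < m → iter t (ℛₘ k m) (pos i , c) ≡ (pos i , c + t)
iter-colours {c = c} zero _ = cong (pos _ ,_) (sym (+-identityʳ c))
iter-colours {c = c} {m = m} {k = k} {i = i} (suc t) c+t<m = begin
    ℛₘ k m (iter t (ℛₘ k m) (pos i , c))  ≡⟨ cong (ℛₘ k m) (iter-colours t (<⇒≤ c+t+1<m)) ⟩
    ℛₘ k m (pos i , c + t)                ≡⟨ ℛₘ-colour c+t+1<m ⟩
    (pos i , suc (c + t))                 ≡⟨ cong (pos i ,_) (+-suc c t) ⟨
    (pos i , c + suc t)                   ∎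
  where
  open ≡-Reasoning
  c+t+1<m : suc (c + t) < m
  c+t+1<m = subst (_< m) (+-suc c t) c+t<m

iter-exit : c < m → iter (m ∸ c) (ℛₘ k m) (pos i , c) ≡ (ℛ k (pos i) , 0)
iter-exit {c = c} {m = m} {k = k} {i = i} c<m = begin
    iter (m ∸ c) R (pos i , c)  ≡⟨ cong (λ n → iter n R (pos i , c)) (+-∸-assoc 1 c<m) ⟩
    R (iter s R (pos i , c))    ≡⟨ cong R (iter-colours s (≤-reflexive last)) ⟩
    R (pos i , c + s)           ≡⟨ ℛₘ-last last ⟩
    (ℛ k (pos i) , 0)           ∎
  where
  open ≡-Reasoning
  R = ℛₘ k m
  s = m ∸ suc c
  last : suc (c + s) ≡ m
  last = m+[n∸m]≡n c<m

iter-neg₂-to-α₂ : c < m → iter (suc c) (ℛₘ k m) (neg₂ , 0) ≡ (pos (k ∸ 1) , c)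
iter-neg₂-to-α₂ {c = c} {m = m} {k = k} c<m = trans (iter-sucʳ (ℛₘ k m) c _) (iter-colours c c<m)

ℛ-pos-Valid : 0 < m → i < k → Valid k m (ℛ k (pos i) , 0)
ℛ-pos-Valid {i = zero}        _   _   = refl
ℛ-pos-Valid {i = suc zero}    _   1<k rewrite ℛ-ρ₁ 1<k = refl
ℛ-pos-Valid {i = suc (suc i)} 0<m i<k rewrite ℛ-descends i i<k = m+n≤o⇒n≤o 2 i<k , 0<m

ℛₘ-Valid : 2 ≤ k → 0 < m → ∀ x → Valid k m x → Valid k m (ℛₘ k m x)
ℛₘ-Valid {m = m} _ 0<m (pos i , c) (i<k , _) with suc c <ᵇ m in c+1<ᵇm
... | true  = i<k , <ᵇ⇒< (suc c) m (subst T (sym c+1<ᵇm) tt)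
... | false = ℛ-pos-Valid 0<m i<k
ℛₘ-Valid (s≤s (s≤s _)) 0<m (neg₁ , _) _ = n≤1+n _ , 0<m
ℛₘ-Valid (s≤s (s≤s _)) 0<m (neg₂ , _) _ = ≤-refl , 0<m

pos-reaches-neg-simple : 0 < m → ∀ i → i < k → c < m →
  ∃₂ λ b j → iter b (ℛₘ k m) (pos i , c) ≡ (negSimple j , 0)
pos-reaches-neg-simple {m = m} {c = c} _ zero _ c<m = m ∸ c , one , iter-exit c<m
pos-reaches-neg-simple {m = m} {c = c} _ (suc zero) 1<k c<m =
  m ∸ c , two , trans (iter-exit c<m) (cong (_, 0) (ℛ-ρ₁ 1<k))
pos-reaches-neg-simple {m = m} {k = k} {c = c} 0<m (suc (suc i)) i<k c<m =
  let b , j , reach = pos-reaches-neg-simple 0<m i (m+n≤o⇒n≤o 2 i<k) 0<m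
  in b + (m ∸ c) , j , (begin
    iter (b + (m ∸ c)) R (pos (2 + i) , c)       ≡⟨ iter-+ R b (m ∸ c) _ ⟩
    iter b R (iter (m ∸ c) R (pos (2 + i) , c))  ≡⟨ cong (iter b R) (iter-exit c<m) ⟩
    iter b R (ℛ k (pos (2 + i)) , 0)             ≡⟨ cong (λ α → iter b R (α , 0)) (ℛ-descends i i<k) ⟩
    iter b R (pos i , 0)                         ≡⟨ reach ⟩
    (negSimple j , 0)                            ∎)
  where
  open ≡-Reasoning
  R = ℛₘ k m

reaches-neg-simple : 0 < m → ∀ x → Valid k m x → ∃₂ λ b j → iter b (ℛₘ k m) x ≡ (negSimple j , 0)
reaches-neg-simple 0<m (pos i , c) (i<k , c<m) = pos-reaches-neg-simple 0<m i i<k c<m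
reaches-neg-simple _   (neg₁ , _)  refl        = 0 , one , refl
reaches-neg-simple _   (neg₂ , _)  refl        = 0 , two , refl

iter-descends : 0 < m → ∀ q → 2 * q + i < k →
  iter (q * m) (ℛₘ k m) (pos (2 * q + i) , 0) ≡ (pos i , 0)
iter-descends _ zero _ = refl
iter-descends {m = m} {i = i} {k = k} 0<m (suc q) h = begin
    iter (m + q * m) R (pos (2 * suc q + i) , 0)           ≡⟨ cong (λ j → iter (m + q * m) R (pos (j + i) , 0)) (*-suc 2 q) ⟩
    iter (m + q * m) R (pos (2 + (2 * q + i)) , 0)         ≡⟨ cong (λ n → iter n R (pos (2 + (2 * q + i)) , 0)) (+-comm m (q * m)) ⟩
    iter (q * m + m) R (pos (2 + (2 * q + i)) , 0)         ≡⟨ iter-+ R (q * m) m _ ⟩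
    iter (q * m) R (iter m R (pos (2 + (2 * q + i)) , 0))  ≡⟨ cong (iter (q * m) R) (iter-exit 0<m) ⟩
    iter (q * m) R (ℛ k (pos (2 + (2 * q + i))) , 0)       ≡⟨ cong (λ α → iter (q * m) R (α , 0)) (ℛ-descends _ h′) ⟩
    iter (q * m) R (pos (2 * q + i) , 0)                   ≡⟨ iter-descends 0<m q (m+n≤o⇒n≤o 2 h′) ⟩
    (pos i , 0)                                            ∎
  where
  open ≡-Reasoning
  R = ℛₘ k m
  h′ : 2 + (2 * q + i) < k
  h′ = subst (λ j → j + i < k) (*-suc 2 q) h

iter-from-pos : 0 < m → r < m → ∀ q → 2 * q + i < k →
  iter (r + q * m) (ℛₘ k m) (pos (2 * q + i) , 0) ≡ (pos i , r)
iter-from-pos {m = m} {r = r} {i = i} {k = k} 0<m r<m q h = begin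
    iter (r + q * m) R (pos (2 * q + i) , 0)         ≡⟨ iter-+ R r (q * m) _ ⟩
    iter r R (iter (q * m) R (pos (2 * q + i) , 0))  ≡⟨ cong (iter r R) (iter-descends 0<m q h) ⟩
    iter r R (pos i , 0)                             ≡⟨ iter-colours r r<m ⟩
    (pos i , r)                                      ∎
  where
  open ≡-Reasoning
  R = ℛₘ k m

iter-neg₁-descent : 0 < m → r < m → ∀ q → k ≡ 2 + (2 * q + i) →
  iter (suc (r + q * m)) (ℛₘ k m) (neg₁ , 0) ≡ (pos i , r)
iter-neg₁-descent {m = m} {r = r} 0<m r<m q refl =
  trans (iter-sucʳ (ℛₘ _ m) (r + q * m) _) (iter-from-pos 0<m r<m q (n≤1+n _))

iter-neg₂-descent : 0 < m → r < m → ∀ q → k ≡ 2 + (2 * q + i) →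
  iter (suc (r + q * m)) (ℛₘ k m) (neg₂ , 0) ≡ (pos (suc i) , r)
iter-neg₂-descent {m = m} {r = r} {i = i} 0<m r<m q refl =
  trans (iter-sucʳ R (r + q * m) _)
    (trans (cong (λ j → iter (r + q * m) R (pos j , 0)) (sym (+-suc (2 * q) i)))
      (iter-from-pos 0<m r<m q (≤-reflexive (cong suc (+-suc (2 * q) i)))))
  where
  R = ℛₘ (2 + (2 * q + i)) m

pos≢negSimple : ∀ j → (pos i , c) ≢ (negSimple j , 0)
pos≢negSimple one ()
pos≢negSimple two ()

iter-neg₂-avoids-neg₁ : t ≤ m → iter t (ℛₘ k m) (neg₂ , 0) ≢ (neg₁ , 0)
iter-neg₂-avoids-neg₁ {t = zero}  _   ()
iter-neg₂-avoids-neg₁ {t = suc t} t<m = pos≢negSimple one ∘ trans (sym (iter-neg₂-to-α₂ t<m))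

exit-avoids-neg₁ : t < m → suc i < k → iter t (ℛₘ k m) (ℛ k (pos (suc i)) , 0) ≢ (neg₁ , 0)
exit-avoids-neg₁ {i = zero}  t<m 1<k rewrite ℛ-ρ₁ 1<k = iter-neg₂-avoids-neg₁ (<⇒≤ t<m)
exit-avoids-neg₁ {t = t} {i = suc i} t<m i+2<k rewrite ℛ-descends i i+2<k =
  pos≢negSimple one ∘ trans (sym (iter-colours t t<m))

iter-pos-avoids-neg₁ : 0 < m → t < m + m → suc i < k →
  iter t (ℛₘ k m) (pos (suc i) , 0) ≢ (neg₁ , 0)
iter-pos-avoids-neg₁ {m = m} {t = t} _ _ _ with t <? m
... | yes t<m = pos≢negSimple one ∘ trans (sym (iter-colours t t<m))
iter-pos-avoids-neg₁ {m = m} {t = t} {i = i} {k = k} 0<m t<2m i+1<k | no t≮m =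
  exit-avoids-neg₁ u<m i+1<k ∘ trans (sym split)
  where
  open ≡-Reasoning
  R = ℛₘ k m
  m≤t = ≮⇒≥ t≮m
  u = t ∸ m
  u<m : u < m
  u<m = +-cancelʳ-< m u m (subst (_< m + m) (sym (m∸n+n≡m m≤t)) t<2m)
  split : iter t R (pos (suc i) , 0) ≡ iter u R (ℛ k (pos (suc i)) , 0)
  split = begin
    iter t R (pos (suc i) , 0)             ≡⟨ cong (λ n → iter n R _) (m∸n+n≡m m≤t) ⟨
    iter (u + m) R (pos (suc i) , 0)       ≡⟨ iter-+ R u m _ ⟩
    iter u R (iter m R (pos (suc i) , 0))  ≡⟨ cong (iter u R) (iter-exit 0<m) ⟩
    iter u R (ℛ k (pos (suc i)) , 0)       ∎

descent-bound : ∀ q → 2 ≤ k → q * m ≤ n → suc n * 3 ≤ m * k + 2 → 2 + 2 * q ≤ k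
descent-bound {k = k} q _ _ _ with 2 + 2 * q ≤? k
... | yes fits = fits
descent-bound zero 2≤k _ _ | no ¬fits = contradiction 2≤k ¬fits
descent-bound {k = k} {m = m} {n = n} (suc q) _ qm≤n bound | no ¬fits =
  ⊥-elim (m+1+n≰m (m * (1 + 2 * suc q) + 2) (begin
    m * (1 + 2 * suc q) + 2 + suc (q * m)  ≡⟨ rearrange m q ⟩
    suc (suc q * m) * 3                    ≤⟨ *-monoˡ-≤ 3 (s≤s qm≤n) ⟩
    suc n * 3                              ≤⟨ bound ⟩
    m * k + 2                              ≤⟨ +-monoˡ-≤ 2 (*-monoʳ-≤ m (s≤s⁻¹ (≰⇒> ¬fits))) ⟩
    m * (1 + 2 * suc q) + 2                ∎))
  where
  open ≤-Reasoning
  rearrange : ∀ m q → m * (1 + 2 * suc q) + 2 + suc (q * m) ≡ suc (suc q * m) * 3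
  rearrange = solve-∀

record ShortRotation (k m p : ℕ) : Set where
  field
    index colour : ℕ
    colour<m     : colour < m
    index+1<k    : suc index < k
    neg₁↦        : iter p (ℛₘ k m) (neg₁ , 0) ≡ (pos index , colour)
    neg₂↦        : iter p (ℛₘ k m) (neg₂ , 0) ≡ (pos (suc index) , colour)

short-rotation : 2 ≤ k → 0 < m → suc n * 3 ≤ m * k + 2 → ShortRotation k m (suc n)
short-rotation {k = k} {m = m} {n = n} 2≤k 0<m bound = record
  { index     = index
  ; colour    = colour
  ; colour<m  = m%n<n n m
  ; index+1<k = subst (suc index <_) (sym k≡) (s≤s (s≤s (m≤n+m index (2 * q))))
  ; neg₁↦     = subst (λ t → iter (suc t) R (neg₁ , 0) ≡ (pos index , colour)) (sym n≡)
                  (iter-neg₁-descent 0<m (m%n<n n m) q k≡)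
  ; neg₂↦     = subst (λ t → iter (suc t) R (neg₂ , 0) ≡ (pos (suc index) , colour)) (sym n≡)
                  (iter-neg₂-descent 0<m (m%n<n n m) q k≡)
  }
  where
  instance
    m≢0 : NonZero m
    m≢0 = >-nonZero 0<m
  R = ℛₘ k m
  q = n / m
  colour = n % m
  n≡ : n ≡ colour + q * m
  n≡ = m≡m%n+[m/n]*n n m
  index = k ∸ (2 + 2 * q)
  k≡ : k ≡ 2 + (2 * q + index)
  k≡ = sym (m+[n∸m]≡n (descent-bound q 2≤k (subst (q * m ≤_) (sym n≡) (m≤n+m (q * m) colour)) bound))

module _ {k m p : ℕ} (short : ShortRotation k m p) where

  open ShortRotation short
  open ≡-Reasoning

  private
    R = ℛₘ k m
    0<m : 0 < m
    0<m = ≤-trans (s≤s z≤n) colour<m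
    2≤k : 2 ≤ k
    2≤k = ≤-trans (s≤s (s≤s z≤n)) index+1<k

  neg-simple-moves : ∀ j → iter p R (negSimple j , 0) ≢ (negSimple j , 0)
  neg-simple-moves one = pos≢negSimple one ∘ trans (sym neg₁↦)
  neg-simple-moves two = pos≢negSimple two ∘ trans (sym neg₂↦)

  rotation-moves-every-vertex : ∀ x → Valid k m x → iter p R x ≢ x
  rotation-moves-every-vertex x vx fixed =
    let b , j , reach = reaches-neg-simple 0<m x vx
    in neg-simple-moves j (begin
      iter p R (negSimple j , 0)  ≡⟨ cong (iter p R) reach ⟨
      iter p R (iter b R x)       ≡⟨ iter-comm R p b x ⟩
      iter b R (iter p R x)       ≡⟨ cong (iter b R) fixed ⟩
      iter b R x                  ≡⟨ reach ⟩
      (negSimple j , 0)           ∎)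

  α₂-not-rotated-to-neg₁ : c < m → suc i ≡ k → iter p R (pos i , c) ≢ (neg₁ , 0)
  α₂-not-rotated-to-neg₁ {c = c} {i = i} c<m α₂ rotated =
    iter-pos-avoids-neg₁ 0<m (+-mono-≤-< c<m colour<m) index+1<k (begin
      iter (suc c + colour) R (pos (suc index) , 0)         ≡⟨ iter-+ R (suc c) colour _ ⟩
      iter (suc c) R (iter colour R (pos (suc index) , 0))  ≡⟨ cong (iter (suc c) R) (iter-colours colour colour<m) ⟩
      iter (suc c) R (pos (suc index) , colour)             ≡⟨ cong (iter (suc c) R) neg₂↦ ⟨
      iter (suc c) R (iter p R (neg₂ , 0))                  ≡⟨ iter-comm R (suc c) p _ ⟩
      iter p R (iter (suc c) R (neg₂ , 0))                  ≡⟨ cong (iter p R) (iter-neg₂-to-α₂ c<m) ⟩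
      iter p R (pos (k ∸ 1) , c)                            ≡⟨ cong (λ j → iter p R (pos (j ∸ 1) , c)) α₂ ⟨
      iter p R (pos i , c)                                  ≡⟨ rotated ⟩
      (neg₁ , 0)                                            ∎)

  α₁-not-rotated-to-neg₂ : c < m → iter p R (pos 0 , c) ≢ (neg₂ , 0)
  α₁-not-rotated-to-neg₂ {c = c} c<m rotated =
    <⇒≱ (subst (λ j → suc j < k) (cong (rootIdx k ∘ proj₁) lands) index+1<k) (m≤n+m∸n k 1)
    where
    s = m ∸ suc c
    m∸c≡1+s : m ∸ c ≡ suc s
    m∸c≡1+s = +-∸-assoc 1 c<m
    lands : (pos index , colour) ≡ (pos (k ∸ 1) , s)
    lands = begin
      (pos index , colour)                   ≡⟨ neg₁↦ ⟨
      iter p R (neg₁ , 0)                    ≡⟨ cong (iter p R) (iter-exit c<m) ⟨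
      iter p R (iter (m ∸ c) R (pos 0 , c))  ≡⟨ iter-comm R p (m ∸ c) _ ⟩
      iter (m ∸ c) R (iter p R (pos 0 , c))  ≡⟨ cong (iter (m ∸ c) R) rotated ⟩
      iter (m ∸ c) R (neg₂ , 0)              ≡⟨ cong (λ t → iter t R (neg₂ , 0)) m∸c≡1+s ⟩
      iter (suc s) R (neg₂ , 0)              ≡⟨ iter-neg₂-to-α₂ (subst (_≤ m) m∸c≡1+s (m∸n≤m m c)) ⟩
      (pos (k ∸ 1) , s)                      ∎

  rotated-not-neg-simple : ∀ j z → Valid k m z → CoeffZero k j (proj₁ z) → iter p R z ≢ (negSimple j , 0)
  rotated-not-neg-simple one (pos _ , _) (_ , c<m) α₂   = α₂-not-rotated-to-neg₁ c<m α₂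
  rotated-not-neg-simple one (neg₁ , _)  _         ()
  rotated-not-neg-simple one (neg₂ , _)  refl      _    = pos≢negSimple one ∘ trans (sym neg₂↦)
  rotated-not-neg-simple two (pos _ , _) (_ , c<m) refl = α₁-not-rotated-to-neg₂ c<m
  rotated-not-neg-simple two (neg₁ , _)  refl      _    = pos≢negSimple two ∘ trans (sym neg₁↦)
  rotated-not-neg-simple two (neg₂ , _)  _         ()

  ¬base-to-rotated : ∀ z → ¬ BaseCompat k z (iter p R z)
  ¬base-to-rotated (_ , _) (one , refl , refl , α₂) = <⇒≢ index+1<k (subst (CoeffZero k one ∘ proj₁) neg₁↦ α₂)
  ¬base-to-rotated (_ , _) (two , refl , refl , α₁) = 0≢1+n (sym (subst (CoeffZero k two ∘ proj₁) neg₂↦ α₁))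

  ¬base-from-rotated : ∀ z → Valid k m z → ¬ BaseCompat k (iter p R z) z
  ¬base-from-rotated z vz (j , α≡ , c≡ , coeff) = rotated-not-neg-simple j z vz coeff (cong₂ _,_ α≡ c≡)

  rotated-incompatible : ∀ x → Valid k m x → ¬ Compatible k m x (iter p R x)
  rotated-incompatible x _ (n , inj₁ base) =
    ¬base-to-rotated (iter n R x) (subst (BaseCompat k (iter n R x)) (iter-comm R n p x) base)
  rotated-incompatible x vx (n , inj₂ base) =
    ¬base-from-rotated (iter n R x) (iter-preserves R {Valid k m} (ℛₘ-Valid 2≤k 0<m _) n vx)
      (subst (λ y → BaseCompat k y (iter n R x)) (iter-comm R n p x) base)

  rotation-leaves-face : ∀ {x f} → Valid k m x → All (Compatible k m x) f → iter p R x ∉ x ∷ f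
  rotation-leaves-face vx _          (here fixed) = rotation-moves-every-vertex _ vx fixed
  rotation-leaves-face vx compatible (there y∈f)  = rotated-incompatible _ vx (lookup compatible y∈f)

conjugate-to-whole : ∀ X → Conjugate k whole X → X ≡ whole
conjugate-to-whole whole     _ = refl
conjugate-to-whole (rank1 _) ()
conjugate-to-whole trivial   ()

lemma7p3 : (k m : ℕ) → 3 ≤ k → 1 ≤ m →
    (d p : ℕ) → 2 < d → p * d ≡ m * k + 2 →
    (X : ParSub) → X ≢ whole →
    (f : List CRoot) → IsFace k m f → Conjugate k (faceType k f) X →
    ¬ FixedBy k m p f
lemma7p3 _ _ _ _ _ _ _ _ X X≢W [] _ conjugate _ = X≢W (conjugate-to-whole X conjugate)
lemma7p3 k m _ _ _ zero _ pd≡mk+2 _ _ (_ ∷ _) _ _ _ = m+1+n≢0 (m * k) (sym pd≡mk+2)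
lemma7p3 k m 3≤k 1≤m _ (suc n) 2<d pd≡mk+2 _ _ (_ ∷ _) (vx ∷ _ , x-compatible ∷ _) _ (rotated⊆f , _) =
  rotation-leaves-face (short-rotation {n = n} (≤-trans (n≤1+n 2) 3≤k) 1≤m bound) vx x-compatible
    (rotated⊆f (∈-map⁺ (iter (suc n) (ℛₘ k m)) (here refl)))
  where
  bound : suc n * 3 ≤ m * k + 2
  bound = ≤-trans (*-monoʳ-≤ (suc n) 2<d) (≤-reflexive pd≡mk+2)
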